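{- For any local threshold-based opinion dynamics $\mathbf{d}$, for any finite undirected unsigned graph $G=(V,E)$ with maximum node degree $\Delta$, and for any opinion configuration $\omega$ of $G$, the $\mathbf{d}$-evolution set $\mathcal{E}_{\mathbf{d}}(G,\omega)$ satisfies \[ \left|\mathcal{E}_{\mathbf{d}}(G,\omega)\right| \leq 4|E|+2|V|+4\Delta(\Delta+1)|V|+2. \]
   Context: Opinions are written as $0$ (negative) and $1$ (positive); an opinion configuration is a map $\omega:V\to\{0,1\}$. For a node $u$, $N(u)$ is its set of neighbors. A local threshold-based dynamics $\mathbf{d}$ is given by a pair of computable threshold functions $\theta^+,\theta^-:\mathbb{N}\to\mathbb{N}$ and maps a configuration $\omega$ to $\omega'=\mathbf{d}(G,\omega)$ defined by: letting $P(u)=|\{v\in N(u):\omega(v)=1\}|$, $\omega'(u)=1$ if either ($\omega(u)=1$ and $P(u)\ge\theta^+(|N(u)|)$) or ($\omega(u)=0$ and $P(u)\ge\theta^-(|N(u)|)$), and $\omega'(u)=0$ otherwise. (E.g. the deterministic majority rule is $\theta^+(k)=\lceil k/2\rceil$, $\theta^-(k)=\lfloor k/2\rfloor+1$.) The $\mathbf{d}$-evolution set $\mathcal{E}_{\mathbf{d}}(G,\omega)$ is the sequence $\langle\omega_1=\omega,\omega_2,\dots,\omega_T\rangle$ of pairwise distinct configurations with $\omega_t=\mathbf{d}(G,\omega_{t-1})$ for $t=2,\dots,T$, and such that $\mathbf{d}(G,\omega_T)=\omega_h$ for some $h\le T$; its size is $T$, i.e. the number of distinct configurations visited before one repeats.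 -}

module Defs where

open import Data.Nat using (ℕ; zero; suc; _+_; _*_; _≤_; _<_; _⊔_; _≤ᵇ_; _<ᵇ_)
open import Data.Bool using (Bool; true; false; _∧_; if_then_else_)
open import Data.Fin using (Fin; toℕ)
open import Data.List using (List; length; filterᵇ; map; foldr; allFin)
open import Data.Nat.ListAction using (sum)
open import Data.Product using (Σ; _×_; _,_)
open import Relation.Binary.PropositionalEquality using (_≡_)
open import Relation.Nullary using (¬_)

record Graph (n : ℕ) : Set where
  field
    adj    : Fin n → Fin n → Bool
    sym    : ∀ u v → adj u v ≡ adj v u
    irrefl : ∀ u → adj u u ≡ false
open Graph public

-- opinion configuration ω : V → {0,1}  (false = 0, true = 1)
Config : ℕ → Set
Config n = Fin n → Bool

nbrs : ∀ {n} → Graph n → Fin n → List (Fin n)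
nbrs G u = filterᵇ (adj G u) (allFin _)

deg : ∀ {n} → Graph n → Fin n → ℕ
deg G u = length (nbrs G u)

maxDeg : ∀ {n} → Graph n → ℕ
maxDeg G = foldr _⊔_ 0 (map (deg G) (allFin _))

numEdges : ∀ {n} → Graph n → ℕ
numEdges {n} G =
  sum (map (λ u → length (filterᵇ (λ v → (toℕ u <ᵇ toℕ v) ∧ adj G u v) (allFin n))) (allFin n))

posNbrs : ∀ {n} → Graph n → Config n → Fin n → ℕ
posNbrs G ω u = length (filterᵇ ω (nbrs G u))

record Dynamics : Set where
  field
    θ⁺ : ℕ → ℕ
    θ⁻ : ℕ → ℕ
open Dynamics public

step : ∀ {n} → Dynamics → Graph n → Config n → Config n
step d G ω u =
  if ω u
  then θ⁺ d (deg G u) ≤ᵇ posNbrs G ω u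
  else θ⁻ d (deg G u) ≤ᵇ posNbrs G ω u

-- iterate k ω = d^k(G, ω)   (so ω_{t} = iterate (t-1) ω)
iterate : ∀ {n} → Dynamics → Graph n → ℕ → Config n → Config n
iterate d G zero    ω = ω
iterate d G (suc k) ω = step d G (iterate d G k ω)

_≈_ : ∀ {n} → Config n → Config n → Set
ω ≈ ω' = ∀ u → ω u ≡ ω' u

-- ⟨ω_1, …, ω_T⟩ is the d-evolution set of (G, ω), of size T:
-- ω_1,…,ω_T pairwise distinct (0-indexed: iterates 0..T-1), and
-- d(G, ω_T) = ω_h for some h ≤ T (0-indexed: iterate T ≈ iterate j, j < T).
IsEvolutionSetSize : ∀ {n} → Dynamics → Graph n → Config n → ℕ → Set
IsEvolutionSetSize d G ω T =
  (∀ i j → i < T → j < T → iterate d G i ω ≈ iterate d G j ω → i ≡ j)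
  × Σ ℕ (λ j → j < T × iterate d G T ω ≈ iterate d G j ω)

-- Goles' energy argument.  Holding opinion 1 with threshold θ⁺ and adopting it
-- with threshold θ⁻ is a threshold network with symmetric weights: threshold θ⁻
-- and a self-loop of weight θ⁻ − θ⁺.  For such a network the energy of two
-- consecutive configurations,
--   E(a , b) = Σᵤ eᵤ(aᵤ , bᵤ) − 2 · #{ (u , v) adjacent : aᵤ = bᵥ = 1 },
-- satisfies E(b , d(b)) + dist(a , d(b)) ≤ E(a , b), dist the Hamming distance.
-- Along the orbit E therefore drops by at least 1 at every step with
-- ω_{t+2} ≠ ω_t, so there are at most Σᵤ (2 + 6 deg u) such steps (the range
-- of E); after the first t with ω_{t+2} = ω_t the orbit cycles with period
-- at most 2.  This bound does not even need the 4|E| term.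
module Submission where

open import Defs hiding (sym)
open import Data.Bool using (Bool; true; false; _xor_; if_then_else_)
open import Data.Fin using (Fin; zero; suc)
open import Data.List using (_∷_; []; length; filterᵇ; tabulate; foldr)
open import Data.List.Membership.Propositional using (_∈_)
open import Data.List.Membership.Propositional.Properties using (∈-map⁺; ∈-allFin)
open import Data.List.Properties using (length-filter)
open import Data.List.Relation.Unary.Any using (here; there)
open import Data.Nat
open import Data.Nat.Properties
open import Algebra.Properties.Semiring.Sum +-*-semiring
  using (sum; sum-syntax; sum-cong-≗; ∑-distrib-+; ∑-comm; *-distribˡ-sum)
open import Data.Nat.Tactic.RingSolver
open import Data.Product using (_,_)
open import Function using (_∘_; id)
open import Relation.Binary.PropositionalEquality
open import Relation.Nullary using (¬_)
open import Relation.Nullary.Decidable using (T?)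
open import Relation.Nullary.Reflects using (Reflects; ofʸ; ofⁿ)

∑-mono-≤ : ∀ {n} {f g : Fin n → ℕ} → (∀ i → f i ≤ g i) → sum f ≤ sum g
∑-mono-≤ {zero}  f≤g = z≤n
∑-mono-≤ {suc n} f≤g = +-mono-≤ (f≤g zero) (∑-mono-≤ (f≤g ∘ suc))

∑-bound : ∀ {n} {f : Fin n → ℕ} {c} → (∀ i → f i ≤ c) → sum f ≤ n * c
∑-bound {zero}  f≤c = z≤n
∑-bound {suc n} f≤c = +-mono-≤ (f≤c zero) (∑-bound (f≤c ∘ suc))

∑≡0⇒≡0 : ∀ {n} (f : Fin n → ℕ) → sum f ≡ 0 → ∀ i → f i ≡ 0
∑≡0⇒≡0 f ∑f≡0 zero    = m+n≡0⇒m≡0 (f zero) ∑f≡0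
∑≡0⇒≡0 f ∑f≡0 (suc i) = ∑≡0⇒≡0 (f ∘ suc) (m+n≡0⇒n≡0 (f zero) ∑f≡0) i

∑-distrib-+-* : ∀ {n} (f g : Fin n → ℕ) k →
  ∑[ i < n ] (f i + k * g i) ≡ sum f + k * sum g
∑-distrib-+-* f g k =
  trans (∑-distrib-+ f (λ i → k * g i)) (cong (sum f +_) (sym (*-distribˡ-sum k g)))

≤-offset : ∀ {m n} k → m + k ≡ n → m ≤ n
≤-offset {m} k refl = m≤m+n m k

∈⇒≤-foldr-⊔ : ∀ {x xs} → x ∈ xs → x ≤ foldr _⊔_ 0 xs
∈⇒≤-foldr-⊔ (here refl) = m≤m⊔n _ _
∈⇒≤-foldr-⊔ (there x∈xs) = ≤-trans (∈⇒≤-foldr-⊔ x∈xs) (m≤n⊔m _ _)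

indicator : Bool → ℕ
indicator false = 0
indicator true  = 1

indicator-*-≤ : ∀ a x → indicator a * x ≤ x
indicator-*-≤ false x = z≤n
indicator-*-≤ true  x = ≤-reflexive (+-identityʳ x)

indicator-xor≡0⇒≡ : ∀ a c → indicator (a xor c) ≡ 0 → a ≡ c
indicator-xor≡0⇒≡ false false _ = refl
indicator-xor≡0⇒≡ true  true  _ = refl

length-filterᵇ²-tabulate : ∀ {A : Set} {n} (p q : A → Bool) (f : Fin n → A) →
  length (filterᵇ q (filterᵇ p (tabulate f)))
    ≡ ∑[ i < n ] (indicator (p (f i)) * indicator (q (f i)))
length-filterᵇ²-tabulate {n = zero}  p q f = refl
length-filterᵇ²-tabulate {n = suc n} p q f with p (f zero)
... | false = length-filterᵇ²-tabulate p q (f ∘ suc)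
... | true with q (f zero)
...   | false = length-filterᵇ²-tabulate p q (f ∘ suc)
...   | true  = cong suc (length-filterᵇ²-tabulate p q (f ∘ suc))

-- F − H is a strictly decreasing potential, stated without truncated subtraction.
descent-length : ∀ (F H : ℕ → ℕ) {m C} →
  (∀ i → i < m → F (suc i) + H i < F i + H (suc i)) →
  F 0 + H m ≤ F m + H 0 + C → m ≤ C
descent-length F H {m} {C} decreases range =
  +-cancelˡ-≤ (F m + H 0) m C (≤-trans (telescope m decreases) range)
  where
  add-step : ∀ {f₀ h₀ f h f′ h′ k} →
    f + h₀ + k ≤ f₀ + h → f′ + h < f + h′ → f′ + h₀ + suc k ≤ f₀ + h′
  add-step {f₀} {h₀} {f} {h} {f′} {h′} {k} ih st = +-cancelʳ-≤ (f + h) _ _ (begin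
    f′ + h₀ + suc k + (f + h)     ≡⟨ solve (f₀ ∷ h₀ ∷ f ∷ h ∷ f′ ∷ h′ ∷ k ∷ []) ⟩
    (f + h₀ + k) + suc (f′ + h)   ≤⟨ +-mono-≤ ih st ⟩
    (f₀ + h) + (f + h′)           ≡⟨ solve (f₀ ∷ h₀ ∷ f ∷ h ∷ f′ ∷ h′ ∷ k ∷ []) ⟩
    f₀ + h′ + (f + h)             ∎)
    where open ≤-Reasoning

  telescope : ∀ k → (∀ i → i < k → F (suc i) + H i < F i + H (suc i)) →
    F k + H 0 + k ≤ F 0 + H k
  telescope zero    _   = ≤-reflexive (+-identityʳ _)
  telescope (suc k) dec =
    add-step {F 0} {H 0} {F k} {H k} {F (suc k)} {H (suc k)}
      (telescope k (λ i i<k → dec i (m<n⇒m<1+n i<k))) (dec k ≤-refl)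

-- Thresholds above deg u + 1 never fire, so clipping them there changes
-- nothing and keeps the energy bounded.
clip-reflects : ∀ θ {δ P} → P ≤ δ → Reflects (θ ⊓ suc δ ≤ P) (θ ≤ᵇ P)
clip-reflects θ {δ} {P} P≤δ with θ ≤ᵇ P | ≤ᵇ-reflects-≤ θ P
... | true  | ofʸ θ≤P = ofʸ (≤-trans (m⊓n≤m θ (suc δ)) θ≤P)
... | false | ofⁿ θ≰P = ofⁿ (<⇒≱ (⊓-pres-m< (≰⇒> θ≰P) (s≤s P≤δ)))

-- 2 + 2 ((s − ½)(a + b) − (s − r) a b) as a function of ones = a + b: Goles'
-- node energy for adopting threshold s and holding threshold r, both lowered
-- by ½ so that every change of opinion strictly decreases the energy.
nodeEnergy : (s r ones : ℕ) → ℕ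
nodeEnergy s r 0             = 2
nodeEnergy s r 1             = 1 + 2 * s
nodeEnergy s r (suc (suc _)) = 2 * s + 2 * r

nodeEnergy-descent : ∀ s r P a b {c} → Reflects ((if b then r else s) ≤ P) c →
  nodeEnergy s r (indicator b + indicator c) + 2 * (indicator a * P) + indicator (a xor c)
    ≤ nodeEnergy s r (indicator a + indicator b) + 2 * (indicator c * P)
nodeEnergy-descent s r P false false (ofʸ s≤P) with m≤n⇒∃[o]m+o≡n s≤P
... | k , refl = ≤-offset (2 * k) (adopt s k)
  where adopt : ∀ s k → 1 + 2 * s + 0 + 1 + 2 * k ≡ 2 + 2 * (1 * (s + k))
        adopt = solve-∀
nodeEnergy-descent s r P false false (ofⁿ _) = ≤-refl
nodeEnergy-descent s r P true false (ofʸ _) = ≤-reflexive (+-identityʳ _)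
nodeEnergy-descent s r P true false (ofⁿ s≰P) with m≤n⇒∃[o]m+o≡n (≰⇒> s≰P)
... | k , refl = ≤-offset (2 * k) (reject P k)
  where reject : ∀ P k → 2 + 2 * (1 * P) + 1 + 2 * k ≡ 1 + 2 * (suc P + k) + 0
        reject = solve-∀
nodeEnergy-descent s r P false true (ofʸ r≤P) with m≤n⇒∃[o]m+o≡n r≤P
... | k , refl = ≤-offset (2 * k) (hold s r k)
  where hold : ∀ s r k → 2 * s + 2 * r + 0 + 1 + 2 * k ≡ 1 + 2 * s + 2 * (1 * (r + k))
        hold = solve-∀
nodeEnergy-descent s r P false true (ofⁿ _) = ≤-reflexive (+-identityʳ _)
nodeEnergy-descent s r P true true (ofʸ _) = ≤-reflexive (+-identityʳ _)
nodeEnergy-descent s r P true true (ofⁿ r≰P) with m≤n⇒∃[o]m+o≡n (≰⇒> r≰P)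
... | k , refl = ≤-offset (2 * k) (drop s P k)
  where drop : ∀ s P k → 1 + 2 * s + 2 * (1 * P) + 1 + 2 * k ≡ 2 * s + 2 * (suc P + k) + 0
        drop = solve-∀

nodeEnergy≤ : ∀ {s r δ} → s ≤ suc δ → r ≤ suc δ → ∀ ones → nodeEnergy s r ones ≤ 4 + 4 * δ
nodeEnergy≤ s≤ r≤ 0 = s≤s (s≤s z≤n)
nodeEnergy≤ {s} {δ = δ} s≤ r≤ 1 = begin
  1 + 2 * s        ≤⟨ +-monoʳ-≤ 1 (*-monoʳ-≤ 2 s≤) ⟩
  1 + 2 * suc δ    ≤⟨ ≤-offset (1 + 2 * δ) (solve (δ ∷ [])) ⟩
  4 + 4 * δ        ∎
  where open ≤-Reasoning
nodeEnergy≤ {s} {r} {δ} s≤ r≤ (suc (suc _)) = begin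
  2 * s + 2 * r           ≤⟨ +-mono-≤ (*-monoʳ-≤ 2 s≤) (*-monoʳ-≤ 2 r≤) ⟩
  2 * suc δ + 2 * suc δ   ≡⟨ solve (δ ∷ []) ⟩
  4 + 4 * δ               ∎
  where open ≤-Reasoning

nodeEnergy-range : ∀ {s r δ} → s ≤ suc δ → r ≤ suc δ →
  ∀ i j → nodeEnergy s r i ≤ nodeEnergy s r j + (2 + 4 * δ)
nodeEnergy-range s≤ r≤ 0 0 = m≤m+n 2 _
nodeEnergy-range {δ = δ} s≤ r≤ 0 (suc j) = ≤-trans (m≤m+n 2 (4 * δ)) (m≤n+m _ _)
nodeEnergy-range s≤ r≤ i 0 = nodeEnergy≤ s≤ r≤ i
nodeEnergy-range s≤ r≤ 1 1 = m≤m+n _ _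
nodeEnergy-range {s} {r} {δ} s≤ r≤ 1 (suc (suc _)) = begin
  1 + 2 * s                     ≤⟨ ≤-offset (2 * r + 1 + 4 * δ) (solve (s ∷ r ∷ δ ∷ [])) ⟩
  2 * s + 2 * r + (2 + 4 * δ)   ∎
  where open ≤-Reasoning
nodeEnergy-range {s} {r} {δ} s≤ r≤ (suc (suc _)) 1 = begin
  2 * s + 2 * r             ≤⟨ +-monoʳ-≤ (2 * s) (*-monoʳ-≤ 2 r≤) ⟩
  2 * s + 2 * suc δ         ≤⟨ ≤-offset (1 + 2 * δ) (solve (s ∷ δ ∷ [])) ⟩
  1 + 2 * s + (2 + 4 * δ)   ∎
  where open ≤-Reasoning
nodeEnergy-range s≤ r≤ (suc (suc _)) (suc (suc _)) = m≤m+n _ _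

hamming : ∀ {n} → Config n → Config n → ℕ
hamming {n} a c = ∑[ u < n ] indicator (a u xor c u)

hamming-pos : ∀ {n} {a c : Config n} → ¬ (a ≈ c) → 0 < hamming a c
hamming-pos {a = a} {c} a≉c = n≢0⇒n>0 λ h≡0 →
  a≉c (λ u → indicator-xor≡0⇒≡ (a u) (c u) (∑≡0⇒≡0 _ h≡0 u))

module _ {n} (G : Graph n) where

  posNbrs≤deg : ∀ ω u → posNbrs G ω u ≤ deg G u
  posNbrs≤deg ω u = length-filter (T? ∘ ω) (nbrs G u)

  deg≤maxDeg : ∀ u → deg G u ≤ maxDeg G
  deg≤maxDeg u = ∈⇒≤-foldr-⊔ (∈-map⁺ (deg G) (∈-allFin u))

  posNbrs-as-sum : ∀ ω u →
    posNbrs G ω u ≡ ∑[ v < n ] (indicator (adj G u v) * indicator (ω v))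
  posNbrs-as-sum ω u = length-filterᵇ²-tabulate (adj G u) ω id

  links : Config n → Config n → ℕ
  links a b = ∑[ u < n ] (indicator (a u) * posNbrs G b u)

  linked : Config n → Config n → Fin n → Fin n → ℕ
  linked a b u v = indicator (a u) * (indicator (adj G u v) * indicator (b v))

  links-as-double-sum : ∀ a b → links a b ≡ ∑[ u < n ] ∑[ v < n ] linked a b u v
  links-as-double-sum a b = sum-cong-≗ λ u →
    trans (cong (indicator (a u) *_) (posNbrs-as-sum b u))
          (*-distribˡ-sum (indicator (a u)) (λ v → indicator (adj G u v) * indicator (b v)))

  linked-swap : ∀ a b u v → linked a b u v ≡ linked b a v u
  linked-swap a b u v =
    trans (cong (λ e → indicator (a u) * (indicator e * indicator (b v))) (Graph.sym G u v))
          (rotate (indicator (a u)) (indicator (adj G v u)) (indicator (b v)))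
    where rotate : ∀ x y z → x * (y * z) ≡ z * (y * x)
          rotate = solve-∀

  links-comm : ∀ a b → links a b ≡ links b a
  links-comm a b = begin
    links a b                               ≡⟨ links-as-double-sum a b ⟩
    ∑[ u < n ] ∑[ v < n ] linked a b u v    ≡⟨ ∑-comm (linked a b) ⟩
    ∑[ v < n ] ∑[ u < n ] linked a b u v    ≡⟨ sum-cong-≗ (λ v → sum-cong-≗ (λ u → linked-swap a b u v)) ⟩
    ∑[ v < n ] ∑[ u < n ] linked b a v u    ≡⟨ links-as-double-sum b a ⟨
    links b a                               ∎
    where open ≡-Reasoning

module _ (d : Dynamics) {n} (G : Graph n) where

  threshold⁺ threshold⁻ : Fin n → ℕ
  threshold⁺ u = θ⁺ d (deg G u) ⊓ suc (deg G u)
  threshold⁻ u = θ⁻ d (deg G u) ⊓ suc (deg G u)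

  step-reflects : ∀ b u →
    Reflects ((if b u then threshold⁺ u else threshold⁻ u) ≤ posNbrs G b u) (step d G b u)
  step-reflects b u with b u
  ... | true  = clip-reflects (θ⁺ d (deg G u)) (posNbrs≤deg G b u)
  ... | false = clip-reflects (θ⁻ d (deg G u)) (posNbrs≤deg G b u)

  energyAt : Config n → Config n → Fin n → ℕ
  energyAt a b u = nodeEnergy (threshold⁻ u) (threshold⁺ u) (indicator (a u) + indicator (b u))

  selfEnergy : Config n → Config n → ℕ
  selfEnergy a b = ∑[ u < n ] energyAt a b u

  energy-descent : ∀ a b → let c = step d G b in
    selfEnergy b c + 2 * links G a b + hamming a c ≤ selfEnergy a b + 2 * links G b c
  energy-descent a b = begin
    selfEnergy b c + 2 * links G a b + hamming a c
      ≡⟨ trans (∑-distrib-+ {n} _ _) (cong (_+ hamming a c) (∑-distrib-+-* {n} _ _ 2)) ⟨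
    ∑[ u < n ] (energyAt b c u + 2 * (indicator (a u) * posNbrs G b u) + indicator (a u xor c u))
      ≤⟨ ∑-mono-≤ (λ u → nodeEnergy-descent _ _ _ (a u) (b u) (step-reflects b u)) ⟩
    ∑[ u < n ] (energyAt a b u + 2 * (indicator (c u) * posNbrs G b u))
      ≡⟨ ∑-distrib-+-* {n} _ _ 2 ⟩
    selfEnergy a b + 2 * links G c b
      ≡⟨ cong (λ l → selfEnergy a b + 2 * l) (links-comm G c b) ⟩
    selfEnergy a b + 2 * links G b c
      ∎
    where
    open ≤-Reasoning
    c = step d G b

  energyAt-range : ∀ a b a′ b′ u →
    energyAt a b u + 2 * (indicator (a′ u) * posNbrs G b′ u)
      ≤ energyAt a′ b′ u + 2 * (indicator (a u) * posNbrs G b u) + (2 + 6 * deg G u)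
  energyAt-range a b a′ b′ u = begin
    energyAt a b u + 2 * (indicator (a′ u) * posNbrs G b′ u)
      ≤⟨ +-mono-≤ (nodeEnergy-range (clipped (θ⁻ d)) (clipped (θ⁺ d)) ones ones′)
                  (*-monoʳ-≤ 2 (≤-trans (indicator-*-≤ (a′ u) _) (posNbrs≤deg G b′ u))) ⟩
    energyAt a′ b′ u + (2 + 4 * deg G u) + 2 * deg G u
      ≤⟨ absorb (energyAt a′ b′ u) (2 * (indicator (a u) * posNbrs G b u)) (deg G u) ⟩
    energyAt a′ b′ u + 2 * (indicator (a u) * posNbrs G b u) + (2 + 6 * deg G u)
      ∎
    where
    open ≤-Reasoning
    ones = indicator (a u) + indicator (b u)
    ones′ = indicator (a′ u) + indicator (b′ u)
    clipped : ∀ θ → θ (deg G u) ⊓ suc (deg G u) ≤ suc (deg G u)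
    clipped θ = m⊓n≤n _ _
    absorb : ∀ e w δ → e + (2 + 4 * δ) + 2 * δ ≤ e + w + (2 + 6 * δ)
    absorb e w δ = ≤-offset w (solve (e ∷ w ∷ δ ∷ []))

  energy-range : ∀ a b a′ b′ →
    selfEnergy a b + 2 * links G a′ b′
      ≤ selfEnergy a′ b′ + 2 * links G a b + ∑[ u < n ] (2 + 6 * deg G u)
  energy-range a b a′ b′ = begin
    selfEnergy a b + 2 * links G a′ b′
      ≡⟨ ∑-distrib-+-* {n} _ _ 2 ⟨
    ∑[ u < n ] (energyAt a b u + 2 * (indicator (a′ u) * posNbrs G b′ u))
      ≤⟨ ∑-mono-≤ (energyAt-range a b a′ b′) ⟩
    ∑[ u < n ] (energyAt a′ b′ u + 2 * (indicator (a u) * posNbrs G b u) + (2 + 6 * deg G u))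
      ≡⟨ trans (∑-distrib-+ {n} _ _) (cong (_+ _) (∑-distrib-+-* {n} _ _ 2)) ⟩
    selfEnergy a′ b′ + 2 * links G a b + ∑[ u < n ] (2 + 6 * deg G u)
      ∎
    where open ≤-Reasoning

  transient-bound : ∀ ω m →
    (∀ i → i < m → ¬ (iterate d G i ω ≈ iterate d G (2 + i) ω)) →
    m ≤ ∑[ u < n ] (2 + 6 * deg G u)
  transient-bound ω m no-return =
    descent-length F H decreases (energy-range (x 0) (x 1) (x m) (x (suc m)))
    where
    x : ℕ → Config n
    x i = iterate d G i ω
    F H : ℕ → ℕ
    F i = selfEnergy (x i) (x (suc i))
    H i = 2 * links G (x i) (x (suc i))
    decreases : ∀ i → i < m → F (suc i) + H i < F i + H (suc i)
    decreases i i<m = begin-strict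
      F (suc i) + H i                                   <⟨ m<m+n _ (hamming-pos (no-return i i<m)) ⟩
      F (suc i) + H i + hamming (x i) (x (2 + i))       ≤⟨ energy-descent (x i) (x (suc i)) ⟩
      F i + H (suc i)                                   ∎
      where open ≤-Reasoning

n*[2+6Δ]≤bound : ∀ E n Δ →
  2 + n * (2 + 6 * Δ) ≤ 4 * E + 2 * n + 4 * Δ * (Δ + 1) * n + 2
n*[2+6Δ]≤bound E n zero    = ≤-offset (4 * E) (solve (E ∷ n ∷ []))
n*[2+6Δ]≤bound E n (suc k) =
  ≤-offset (4 * E + (4 * k * k + 6 * k + 2) * n) (solve (E ∷ n ∷ k ∷ []))

theorem3 : (d : Dynamics) (n : ℕ) (G : Graph n) (ω : Config n) (T : ℕ) →
    IsEvolutionSetSize d G ω T →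
    T ≤ 4 * numEdges G + 2 * n + 4 * maxDeg G * (maxDeg G + 1) * n + 2
theorem3 d n G ω zero          _              = z≤n
theorem3 d n G ω (suc zero)    _              = ≤-trans (s≤s z≤n) (m≤n+m 2 _)
theorem3 d n G ω (suc (suc m)) (distinct , _) = begin
  2 + m
    ≤⟨ +-monoʳ-≤ 2 (transient-bound d G ω m no-return) ⟩
  2 + ∑[ u < n ] (2 + 6 * deg G u)
    ≤⟨ +-monoʳ-≤ 2 (∑-bound (λ u → +-monoʳ-≤ 2 (*-monoʳ-≤ 6 (deg≤maxDeg G u)))) ⟩
  2 + n * (2 + 6 * maxDeg G)
    ≤⟨ n*[2+6Δ]≤bound (numEdges G) n (maxDeg G) ⟩
  4 * numEdges G + 2 * n + 4 * maxDeg G * (maxDeg G + 1) * n + 2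
    ∎
  where
  open ≤-Reasoning
  no-return : ∀ i → i < m → ¬ (iterate d G i ω ≈ iterate d G (2 + i) ω)
  no-return i i<m returns =
    <⇒≢ (m<n+m i z<s)
        (distinct i (2 + i) (m<n⇒m<1+n (m<n⇒m<1+n i<m)) (s≤s (s≤s i<m)) returns)
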